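{- There exist disjoint schemas $\mathscr D,\mathscr Q$ and a DTGD$[\mathsf{UCQ}]$-ontology over $(\mathscr D,\mathscr Q)$ that is not defined by any finite set of TGDs.
   Context: Terms are constants (set $\Delta$), labeled nulls, or variables; a database is a finite set of relational atoms containing no variables or nulls; $adom(D)$ its constants. A Boolean UCQ is a sentence built from relational atoms (constants allowed) with only $\wedge,\vee,\exists$; $const(q)$ its constants. A DTGD is $\forall\mathbf x\forall\mathbf y(\phi(\mathbf x,\mathbf y)\rightarrow\exists\mathbf z(\psi_1(\mathbf x,\mathbf z)\vee\dots\vee\psi_k(\mathbf x,\mathbf z)))$ with $\phi,\psi_i$ conjunctions of relational atoms, each variable of $\mathbf x$ in $\phi$; a TGD is a DTGD with $k=1$. $D\cup\Sigma\vDash q$ means every instance containing $D$ and satisfying $\Sigma$ satisfies $q$. An OMQA$[\mathsf{UCQ}]$-ontology over $(\mathscr D,\mathscr Q)$ is a set $O$ of pairs $(D,q)$, $D$ a nonempty $\mathscr D$-database, $q$ a Boolean $\mathscr Q$-UCQ with $const(q)\subseteq adom(D)$, closed under query conjunction, query implication ($q\vDash p$, $(D,q)\in O\Rightarrow(D,p)\in O$), injective $const(q)$-fixing database homomorphisms, and partial injective constant renamings $\tau:\Delta\to\Delta$ ($(D,q)\in O\Rightarrow(\tau(D),\tau(q))\in O$). $O$ is defined by $\Sigma$ if $O=\{(D,q): D$ a $\mathscr D$-database, $q$ a Boolean $\mathscr Q$-UCQ, $D\cup\Sigma\vDash q\}$. A DTGD$[\mathsf{UCQ}]$-ontology is an OMQA$[\mathsf{UCQ}]$-ontology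 defined by some finite set of DTGDs. -}

module Defs where

open import Level using (Level) renaming (suc to lsuc)
open import Data.Nat using (ℕ; _≟_)
open import Data.Bool using (if_then_else_)
open import Data.Product using (Σ; Σ-syntax; _×_; _,_; proj₁; proj₂)
open import Data.Sum using (_⊎_)
open import Data.Empty using (⊥)
open import Data.List using (List; []; _∷_; map)
open import Data.List.NonEmpty using (List⁺; toList; [_])
open import Data.List.Membership.Propositional using (_∈_)
open import Data.List.Relation.Unary.All using (All)
open import Data.List.Relation.Unary.Any using (Any)
open import Data.Vec using (Vec)
import Data.Vec as Vec
import Data.Vec.Membership.Propositional as VecMem
open import Relation.Nullary using (¬_; does)
open import Relation.Binary.PropositionalEquality using (_≡_; _≢_)

-- Signature: a relation symbol is a pair (name , arity).
-- Constants (Δ), labelled nulls and variables are all indexed by ℕ.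

Rel : Set
Rel = ℕ × ℕ

arity : Rel → ℕ
arity = proj₂

Schema : Set
Schema = List Rel

Disjoint : Schema → Schema → Set
Disjoint 𝒟 𝒬 = ∀ r s → r ∈ 𝒟 → s ∈ 𝒬 → proj₁ r ≢ proj₁ s

record Atom (T : Set) : Set where
  constructor mkAtom
  field
    rel  : Rel
    args : Vec T (arity rel)
open Atom public

mapAtom : {A B : Set} → (A → B) → Atom A → Atom B
mapAtom f (mkAtom r as) = mkAtom r (Vec.map f as)

-- Databases (finite sets of atoms over constants)

Database : Set
Database = List (Atom ℕ)

IsDB : Schema → Database → Set
IsDB 𝒟 D = All (λ a → rel a ∈ 𝒟) D

InAdom : ℕ → Database → Set
InAdom c D = Any (λ a → c VecMem.∈ args a) D

InjOn : (ℕ → ℕ) → Database → Set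
InjOn f D = ∀ a b → InAdom a D → InAdom b D → f a ≡ f b → a ≡ b

-- Instances: arbitrary (possibly infinite) sets of atoms over constants
-- and labelled nulls.

data Val : Set where
  cst : ℕ → Val
  nul : ℕ → Val

Instance : Set₁
Instance = Atom Val → Set

Contains : Instance → Database → Set
Contains I D = ∀ a → a ∈ D → I (mapAtom cst a)

data QTerm : Set where
  con : ℕ → QTerm
  var : ℕ → QTerm

data UCQ : Set where
  atom : Atom QTerm → UCQ
  _∧_  : UCQ → UCQ → UCQ
  _∨_  : UCQ → UCQ → UCQ
  ex   : ℕ → UCQ → UCQ

data FreeIn (x : ℕ) : UCQ → Set where
  atm : ∀ {a} → var x VecMem.∈ args a → FreeIn x (atom a)
  ∧l  : ∀ {q p} → FreeIn x q → FreeIn x (q ∧ p)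
  ∧r  : ∀ {q p} → FreeIn x p → FreeIn x (q ∧ p)
  ∨l  : ∀ {q p} → FreeIn x q → FreeIn x (q ∨ p)
  ∨r  : ∀ {q p} → FreeIn x p → FreeIn x (q ∨ p)
  exi : ∀ {y q} → x ≢ y → FreeIn x q → FreeIn x (ex y q)

Boolean : UCQ → Set
Boolean q = ∀ x → ¬ FreeIn x q

data ConstIn (c : ℕ) : UCQ → Set where
  atm : ∀ {a} → con c VecMem.∈ args a → ConstIn c (atom a)
  ∧l  : ∀ {q p} → ConstIn c q → ConstIn c (q ∧ p)
  ∧r  : ∀ {q p} → ConstIn c p → ConstIn c (q ∧ p)
  ∨l  : ∀ {q p} → ConstIn c q → ConstIn c (q ∨ p)
  ∨r  : ∀ {q p} → ConstIn c p → ConstIn c (q ∨ p)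
  exi : ∀ {y q} → ConstIn c q → ConstIn c (ex y q)

ConstsIn : UCQ → Database → Set
ConstsIn q D = ∀ c → ConstIn c q → InAdom c D

QOver : Schema → UCQ → Set
QOver 𝒬 (atom a) = rel a ∈ 𝒬
QOver 𝒬 (q ∧ p)  = QOver 𝒬 q × QOver 𝒬 p
QOver 𝒬 (q ∨ p)  = QOver 𝒬 q × QOver 𝒬 p
QOver 𝒬 (ex _ q) = QOver 𝒬 q

renT : (ℕ → ℕ) → QTerm → QTerm
renT τ (con c) = con (τ c)
renT τ (var x) = var x

renQ : (ℕ → ℕ) → UCQ → UCQ
renQ τ (atom a) = atom (mapAtom (renT τ) a)
renQ τ (q ∧ p)  = renQ τ q ∧ renQ τ p
renQ τ (q ∨ p)  = renQ τ q ∨ renQ τ p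
renQ τ (ex x q) = ex x (renQ τ q)

_[_↦_] : (ℕ → Val) → ℕ → Val → (ℕ → Val)
(ν [ x ↦ v ]) y = if does (y ≟ x) then v else ν y

evalT : (ℕ → Val) → QTerm → Val
evalT ν (con c) = cst c
evalT ν (var x) = ν x

Sat : Instance → (ℕ → Val) → UCQ → Set
Sat I ν (atom a) = I (mapAtom (evalT ν) a)
Sat I ν (q ∧ p)  = Sat I ν q × Sat I ν p
Sat I ν (q ∨ p)  = Sat I ν q ⊎ Sat I ν p
Sat I ν (ex x q) = Σ Val (λ v → Sat I (ν [ x ↦ v ]) q)

Models : Instance → UCQ → Set
Models I q = ∀ ν → Sat I ν q

_⊨_ : UCQ → UCQ → Set₁
q ⊨ p = ∀ (I : Instance) → Models I q → Models I p

-- Disjunctive TGDs.  Atoms of dependencies have variables (ℕ) as terms.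
-- Variables of the body are universally quantified; head variables not
-- occurring in the body are existentially quantified.

record DTGD : Set where
  constructor mkDTGD
  field
    body  : List⁺ (Atom ℕ)
    heads : List⁺ (List⁺ (Atom ℕ))   -- disjuncts ψ₁ … ψₖ, k ≥ 1
open DTGD public

record TGD : Set where
  constructor mkTGD
  field
    tbody : List⁺ (Atom ℕ)
    thead : List⁺ (Atom ℕ)
open TGD public

toDTGD : TGD → DTGD
toDTGD t = mkDTGD (tbody t) [ thead t ]

HoldsConj : Instance → (ℕ → Val) → List⁺ (Atom ℕ) → Set
HoldsConj I h as = All (λ a → I (mapAtom h a)) (toList as)

BodyVar : ℕ → DTGD → Set
BodyVar v σ = Any (λ a → v VecMem.∈ args a) (toList (body σ))

SatDTGD : Instance → DTGD → Set
SatDTGD I σ =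
  ∀ (h : ℕ → Val) → HoldsConj I h (body σ) →
  Any (λ ψ → Σ[ h′ ∈ (ℕ → Val) ]
               ((∀ v → BodyVar v σ → h′ v ≡ h v) × HoldsConj I h′ ψ))
      (toList (heads σ))

Entails : Database → List DTGD → UCQ → Set₁
Entails D Σd q =
  ∀ (I : Instance) → Contains I D → All (SatDTGD I) Σd → Models I q

Ont : Set₂
Ont = Database → UCQ → Set₁

Admissible : Schema → Schema → Database → UCQ → Set
Admissible 𝒟 𝒬 D q = (D ≢ []) × IsDB 𝒟 D × Boolean q × QOver 𝒬 q × ConstsIn q D

Defined : Schema → Schema → List DTGD → Ont
Defined 𝒟 𝒬 Σd D q = Admissible 𝒟 𝒬 D q × Entails D Σd q

SameOnt : Ont → Ont → Set₁
SameOnt O O′ = ∀ D q → (O D q → O′ D q) × (O′ D q → O D q)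

record IsOMQA (𝒟 𝒬 : Schema) (O : Ont) : Set₁ where
  field
    admissible : ∀ D q → O D q → Admissible 𝒟 𝒬 D q
    conj : ∀ D q p → O D q → O D p → O D (q ∧ p)
    impl : ∀ D q p → O D q → Boolean p → QOver 𝒬 p → ConstsIn p D →
           q ⊨ p → O D p
    hom  : ∀ D D′ q (h : ℕ → ℕ) → O D q → IsDB 𝒟 D′ → InjOn h D →
           (∀ c → ConstIn c q → h c ≡ c) →
           (∀ a → a ∈ D → mapAtom h a ∈ D′) → O D′ q
    ren  : ∀ D q (τ : ℕ → ℕ) → O D q → InjOn τ D →
           O (map (mapAtom τ) D) (renQ τ q)

IsDTGDOntology : Schema → Schema → List DTGD → Set₁
IsDTGDOntology 𝒟 𝒬 Σd = IsOMQA 𝒟 𝒬 (Defined 𝒟 𝒬 Σd)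

DefinedByTGDs : Schema → Schema → Ont → List TGD → Set₁
DefinedByTGDs 𝒟 𝒬 O T = SameOnt O (Defined 𝒟 𝒬 (map toDTGD T))

-- The ontology is defined by the single DTGD  P(x) → A(x) ∨ B(x).  As it has no
-- existential variables, its models pull back along any renaming of constants,
-- which yields the closure properties of an OMQA ontology.  The ontology contains
-- ({P(0)}, A(0) ∨ B(0)) but not ({P(0), P(1)}, (A(0) ∧ A(1)) ∨ (B(0) ∧ B(1))),
-- as the model {P(0), P(1), A(0), B(1)} shows.  Models of TGDs, however, are
-- closed under products: if J is a model of {P(0), P(1)} and of a set T of TGDs,
-- then J ⊗ J, in which the constant c stands for the pair (c, 1), is a model of
-- {P(0)} and T.  So if T defined the ontology, J ⊗ J would satisfy A(0) ∨ B(0),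
-- whence J would satisfy the second query, and the second pair would belong to
-- the ontology after all.
module Submission where

open import Defs
open import Data.Product using (Σ-syntax; _×_)
open import Data.List using (List)
open import Relation.Nullary using (¬_)

open import Function using (_∘_)
open import Data.Nat using (ℕ; zero; suc; _+_; _≟_; _≡ᵇ_)
open import Data.Nat.Properties using (+-suc; +-identityʳ; ≡⇒≡ᵇ)
open import Data.Bool using (T; true; false)
open import Data.Product using (∃; _,_; proj₁; proj₂)
open import Data.Sum using (_⊎_; inj₁; inj₂)
open import Data.Empty using (⊥; ⊥-elim)
open import Data.Unit using (⊤; tt)
open import Data.List using ([]; _∷_; map)
open import Data.List.NonEmpty using (toList)
import Data.List.NonEmpty as List⁺
open import Data.List.Membership.Propositional using (_∈_; find; lose)
open import Data.List.Membership.Propositional.Properties using (∈-map⁺)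
open import Data.List.Relation.Unary.All using (All; []; _∷_)
import Data.List.Relation.Unary.All as All
import Data.List.Relation.Unary.All.Properties as All
open import Data.List.Relation.Unary.Any using (here; there)
import Data.List.Relation.Unary.Any as Any
open import Data.Vec using (Vec)
import Data.Vec as Vec
import Data.Vec.Properties as Vec
import Data.Vec.Relation.Unary.Any as VecAny
import Data.Vec.Membership.Propositional as Vec
import Data.Vec.Membership.Propositional.Properties as Vec
open import Relation.Nullary using (Dec; yes; no)
open import Relation.Binary.PropositionalEquality

private
  variable
    X Y Z : Set
    n : ℕ

map-cong-∈ : {f g : X → Y} (xs : Vec X n) →
             (∀ {x} → x Vec.∈ xs → f x ≡ g x) → Vec.map f xs ≡ Vec.map g xs
map-cong-∈ Vec.[]       e = refl
map-cong-∈ (x Vec.∷ xs) e = cong₂ Vec._∷_ (e (VecAny.here refl)) (map-cong-∈ xs (e ∘ VecAny.there))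

∈-map⁻ : (f : X → Y) {y : Y} (xs : Vec X n) → y Vec.∈ Vec.map f xs → ∃ λ x → x Vec.∈ xs × y ≡ f x
∈-map⁻ f (x Vec.∷ xs) (VecAny.here e) = x , VecAny.here refl , e
∈-map⁻ f (x Vec.∷ xs) (VecAny.there m) with ∈-map⁻ f xs m
... | x′ , x′∈xs , e = x′ , VecAny.there x′∈xs , e

mapAtom-∘ : (f : Y → Z) (g : X → Y) (a : Atom X) →
            mapAtom f (mapAtom g a) ≡ mapAtom (f ∘ g) a
mapAtom-∘ f g (mkAtom r as) = cong (mkAtom r) (sym (Vec.map-∘ f g as))

mapAtom-cong-∈ : {f g : X → Y} (a : Atom X) →
                 (∀ {x} → x Vec.∈ args a → f x ≡ g x) → mapAtom f a ≡ mapAtom g a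
mapAtom-cong-∈ (mkAtom r as) e = cong (mkAtom r) (map-cong-∈ as e)

freeIn-renQ : ∀ (τ : ℕ → ℕ) {x} q → FreeIn x (renQ τ q) → FreeIn x q
freeIn-renQ τ (atom (mkAtom r as)) (atm m) with ∈-map⁻ (renT τ) as m
... | var _ , t∈as , refl = atm t∈as
freeIn-renQ τ (q ∧ p)  (∧l f)      = ∧l (freeIn-renQ τ q f)
freeIn-renQ τ (q ∧ p)  (∧r f)      = ∧r (freeIn-renQ τ p f)
freeIn-renQ τ (q ∨ p)  (∨l f)      = ∨l (freeIn-renQ τ q f)
freeIn-renQ τ (q ∨ p)  (∨r f)      = ∨r (freeIn-renQ τ p f)
freeIn-renQ τ (ex y q) (exi x≢y f) = exi x≢y (freeIn-renQ τ q f)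

boolean-renQ : ∀ (τ : ℕ → ℕ) q → Boolean q → Boolean (renQ τ q)
boolean-renQ τ q bq x = bq x ∘ freeIn-renQ τ q

constIn-renQ : ∀ (τ : ℕ → ℕ) {c} q → ConstIn c (renQ τ q) → ∃ λ c′ → c ≡ τ c′ × ConstIn c′ q
constIn-renQ τ (atom (mkAtom r as)) (atm m) with ∈-map⁻ (renT τ) as m
... | con c′ , t∈as , refl = c′ , refl , atm t∈as
constIn-renQ τ (q ∧ p)  (∧l k)  = let c′ , e , k′ = constIn-renQ τ q k in c′ , e , ∧l k′
constIn-renQ τ (q ∧ p)  (∧r k)  = let c′ , e , k′ = constIn-renQ τ p k in c′ , e , ∧r k′
constIn-renQ τ (q ∨ p)  (∨l k)  = let c′ , e , k′ = constIn-renQ τ q k in c′ , e , ∨l k′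
constIn-renQ τ (q ∨ p)  (∨r k)  = let c′ , e , k′ = constIn-renQ τ p k in c′ , e , ∨r k′
constIn-renQ τ (ex y q) (exi k) = let c′ , e , k′ = constIn-renQ τ q k in c′ , e , exi k′

qOver-renQ : ∀ 𝒬 (τ : ℕ → ℕ) q → QOver 𝒬 q → QOver 𝒬 (renQ τ q)
qOver-renQ 𝒬 τ (atom a)  o        = o
qOver-renQ 𝒬 τ (q ∧ p)  (o , o′) = qOver-renQ 𝒬 τ q o , qOver-renQ 𝒬 τ p o′
qOver-renQ 𝒬 τ (q ∨ p)  (o , o′) = qOver-renQ 𝒬 τ q o , qOver-renQ 𝒬 τ p o′
qOver-renQ 𝒬 τ (ex y q) o        = qOver-renQ 𝒬 τ q o

renQ-fixing : ∀ (τ : ℕ → ℕ) q → (∀ c → ConstIn c q → τ c ≡ c) → renQ τ q ≡ q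
renQ-fixing τ (atom (mkAtom r as)) fix = cong (atom ∘ mkAtom r) (trans (map-cong-∈ as fixed) (Vec.map-id as))
  where
  fixed : ∀ {t} → t Vec.∈ as → renT τ t ≡ t
  fixed {con c} t∈as = cong con (fix c (atm t∈as))
  fixed {var x} _    = refl
renQ-fixing τ (q ∧ p)  fix = cong₂ _∧_ (renQ-fixing τ q (λ c → fix c ∘ ∧l)) (renQ-fixing τ p (λ c → fix c ∘ ∧r))
renQ-fixing τ (q ∨ p)  fix = cong₂ _∨_ (renQ-fixing τ q (λ c → fix c ∘ ∨l)) (renQ-fixing τ p (λ c → fix c ∘ ∨r))
renQ-fixing τ (ex x q) fix = cong (ex x) (renQ-fixing τ q (λ c → fix c ∘ exi))

sat-free : ∀ (I : Instance) q {ν ν′ : ℕ → Val} → (∀ y → FreeIn y q → ν y ≡ ν′ y) →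
           Sat I ν q → Sat I ν′ q
sat-free I (atom (mkAtom r as)) {ν} {ν′} e s = subst (I ∘ mkAtom r) (map-cong-∈ as agree) s
  where
  agree : ∀ {t} → t Vec.∈ as → evalT ν t ≡ evalT ν′ t
  agree {con c} _    = refl
  agree {var y} t∈as = e y (atm t∈as)
sat-free I (q ∧ p) e (s , t) = sat-free I q (λ y → e y ∘ ∧l) s , sat-free I p (λ y → e y ∘ ∧r) t
sat-free I (q ∨ p) e (inj₁ s) = inj₁ (sat-free I q (λ y → e y ∘ ∨l) s)
sat-free I (q ∨ p) e (inj₂ s) = inj₂ (sat-free I p (λ y → e y ∘ ∨r) s)
sat-free I (ex x q) {ν} {ν′} e (v , s) = v , sat-free I q agree s
  where
  agree : ∀ y → FreeIn y q → (ν [ x ↦ v ]) y ≡ (ν′ [ x ↦ v ]) y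
  agree y f with y ≡ᵇ x in y≡ᵇx
  ... | true  = refl
  ... | false = e y (exi (λ y≡x → subst T y≡ᵇx (≡⇒≡ᵇ y x y≡x)) f)

sentence-sat : ∀ (I : Instance) q {ν ν′ : ℕ → Val} → Boolean q → Sat I ν q → Sat I ν′ q
sentence-sat I q bq = sat-free I q (λ y f → ⊥-elim (bq y f))

pullback : (Val → Val) → Instance → Instance
pullback f I = I ∘ mapAtom f

∘-update : (f : Val → Val) (ν : ℕ → Val) (x : ℕ) (v : Val) (y : ℕ) →
           f ((ν [ x ↦ v ]) y) ≡ ((f ∘ ν) [ x ↦ f v ]) y
∘-update f ν x v y with y ≡ᵇ x
... | true  = refl
... | false = refl

sat-pullback : ∀ (I : Instance) (f : Val → Val) (τ : ℕ → ℕ) q {ν : ℕ → Val} →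
               (∀ c → ConstIn c q → f (cst c) ≡ cst (τ c)) →
               Sat (pullback f I) ν q → Sat I (f ∘ ν) (renQ τ q)
sat-pullback I f τ (atom (mkAtom r as)) {ν} e s = subst (I ∘ mkAtom r) pushed s
  where
  commutes : ∀ {t} → t Vec.∈ as → f (evalT ν t) ≡ evalT (f ∘ ν) (renT τ t)
  commutes {con c} t∈as = e c (atm t∈as)
  commutes {var x} _    = refl
  pushed : Vec.map f (Vec.map (evalT ν) as) ≡ Vec.map (evalT (f ∘ ν)) (Vec.map (renT τ) as)
  pushed = begin
    Vec.map f (Vec.map (evalT ν) as)                ≡⟨ Vec.map-∘ f (evalT ν) as ⟨
    Vec.map (f ∘ evalT ν) as                        ≡⟨ map-cong-∈ as commutes ⟩
    Vec.map (evalT (f ∘ ν) ∘ renT τ) as             ≡⟨ Vec.map-∘ (evalT (f ∘ ν)) (renT τ) as ⟩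
    Vec.map (evalT (f ∘ ν)) (Vec.map (renT τ) as)   ∎
    where open ≡-Reasoning
sat-pullback I f τ (q ∧ p) e (s , t) =
  sat-pullback I f τ q (λ c → e c ∘ ∧l) s , sat-pullback I f τ p (λ c → e c ∘ ∧r) t
sat-pullback I f τ (q ∨ p) e (inj₁ s) = inj₁ (sat-pullback I f τ q (λ c → e c ∘ ∨l) s)
sat-pullback I f τ (q ∨ p) e (inj₂ s) = inj₂ (sat-pullback I f τ p (λ c → e c ∘ ∨r) s)
sat-pullback I f τ (ex x q) {ν} e (v , s) =
  f v , sat-free I (renQ τ q) (λ y _ → ∘-update f ν x v y) (sat-pullback I f τ q (λ c → e c ∘ exi) s)

-- Full DTGDs are preserved by pullbacks

FullDTGD : DTGD → Set
FullDTGD σ = ∀ {ψ a v} → ψ ∈ toList (heads σ) → a ∈ toList ψ → v Vec.∈ args a → BodyVar v σ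

holds-pullback⁻ : ∀ (I : Instance) (f : Val → Val) {h} ψ →
                  HoldsConj (pullback f I) h ψ → HoldsConj I (f ∘ h) ψ
holds-pullback⁻ I f {h} ψ = All.map (λ {a} → subst I (mapAtom-∘ f h a))

holds-pullback⁺ : ∀ (I : Instance) (f : Val → Val) {h} ψ →
                  HoldsConj I (f ∘ h) ψ → HoldsConj (pullback f I) h ψ
holds-pullback⁺ I f {h} ψ = All.map (λ {a} → subst I (sym (mapAtom-∘ f h a)))

holds-cong-∈ : ∀ (I : Instance) {g h : ℕ → Val} ψ →
               (∀ {a v} → a ∈ toList ψ → v Vec.∈ args a → g v ≡ h v) →
               HoldsConj I g ψ → HoldsConj I h ψ
holds-cong-∈ I ψ e hg = All.tabulate λ {a} a∈ψ → subst I (mapAtom-cong-∈ a (e a∈ψ)) (All.lookup hg a∈ψ)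

-- The witness for the head is the body match itself, as the head has no existential variables.
full-pullback : ∀ (I : Instance) (f : Val → Val) σ → FullDTGD σ → SatDTGD I σ → SatDTGD (pullback f I) σ
full-pullback I f σ full sat h hb with find (sat (f ∘ h) (holds-pullback⁻ I f (body σ) hb))
... | ψ , ψ∈heads , h′ , h′≡f∘h , hψ =
  lose ψ∈heads (h , (λ _ _ → refl) ,
    holds-pullback⁺ I f ψ (holds-cong-∈ I ψ (λ a∈ψ v∈a → h′≡f∘h _ (full ψ∈heads a∈ψ v∈a)) hψ))

full-pullbacks : ∀ (I : Instance) (f : Val → Val) {Σd} → All FullDTGD Σd →
                 All (SatDTGD I) Σd → All (SatDTGD (pullback f I)) Σd
full-pullbacks I f []             []           = []
full-pullbacks I f (full ∷ fulls) (sat ∷ sats) = full-pullback I f _ full sat ∷ full-pullbacks I f fulls sats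

-- Full DTGDs define OMQA ontologies

DBHom : (ℕ → ℕ) → Database → Database → Set
DBHom h D D′ = ∀ a → a ∈ D → mapAtom h a ∈ D′

liftConst : (ℕ → ℕ) → Val → Val
liftConst h (cst c) = cst (h c)
liftConst h (nul m) = nul m

contains-pullback : ∀ (I : Instance) {h D D′} → Contains I D′ → DBHom h D D′ →
                    Contains (pullback (liftConst h) I) D
contains-pullback I {h} c hom a a∈D =
  subst I (trans (mapAtom-∘ cst h a) (sym (mapAtom-∘ (liftConst h) cst a))) (c _ (hom a a∈D))

entails-image : ∀ {Σd D D′ h} q → All FullDTGD Σd → Boolean q → DBHom h D D′ →
                Entails D Σd q → Entails D′ Σd (renQ h q)
entails-image {h = h} q fulls bq hom E I c sats ν =
  sentence-sat I (renQ h q) (boolean-renQ h q bq)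
    (sat-pullback I (liftConst h) h q (λ _ _ → refl)
      (E (pullback (liftConst h) I) (contains-pullback I c hom)
         (full-pullbacks I (liftConst h) fulls sats)
         (λ _ → cst 0)))

adom-image : ∀ {h D D′ c} → DBHom h D D′ → InAdom c D → InAdom (h c) D′
adom-image {h} hom c∈D with find c∈D
... | a , a∈D , c∈a = lose (hom a a∈D) (Vec.∈-map⁺ h c∈a)

nonempty-image : ∀ {h D D′} → DBHom h D D′ → D ≢ [] → D′ ≢ []
nonempty-image {D = []}    hom D≢[] = ⊥-elim (D≢[] refl)
nonempty-image {D = a ∷ D} hom _ refl with hom a (here refl)
... | ()

defined-image : ∀ {𝒟 𝒬 Σd D D′ h} q → All FullDTGD Σd → IsDB 𝒟 D′ → DBHom h D D′ →
                Defined 𝒟 𝒬 Σd D q → Defined 𝒟 𝒬 Σd D′ (renQ h q)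
defined-image {𝒬 = 𝒬} {h = h} q fulls db′ hom ((D≢[] , _ , bq , oq , cq) , E) =
  (nonempty-image hom D≢[] , db′ , boolean-renQ h q bq , qOver-renQ 𝒬 h q oq , consts) ,
  entails-image q fulls bq hom E
  where
  consts : ConstsIn (renQ h q) _
  consts c k with constIn-renQ h q k
  ... | c′ , refl , k′ = adom-image hom (cq c′ k′)

full-DTGDs-define-OMQA : ∀ {𝒟 𝒬 Σd} → All FullDTGD Σd → IsOMQA 𝒟 𝒬 (Defined 𝒟 𝒬 Σd)
full-DTGDs-define-OMQA {𝒟} {𝒬} {Σd} fulls = record
  { admissible = λ _ _ → proj₁
  ; conj       = conj
  ; impl       = λ D q p ((D≢[] , db , _) , E) bp op cp q⊨p →
                   (D≢[] , db , bp , op , cp) , λ I c sats → q⊨p I (E I c sats)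
  ; hom        = λ D D′ q h o db′ _ fix hom →
                   subst (Defined 𝒟 𝒬 Σd D′) (renQ-fixing h q fix) (defined-image q fulls db′ hom o)
  ; ren        = λ D q τ o _ →
                   defined-image q fulls (All.map⁺ (proj₁ (proj₂ (proj₁ o)))) (λ _ → ∈-map⁺ (mapAtom τ)) o
  }
  where
  conj : ∀ D q p → Defined 𝒟 𝒬 Σd D q → Defined 𝒟 𝒬 Σd D p → Defined 𝒟 𝒬 Σd D (q ∧ p)
  conj D q p ((D≢[] , db , bq , oq , cq) , Eq) ((_ , _ , bp , op , cp) , Ep) =
    (D≢[] , db , bqp , (oq , op) , cqp) , λ I c sats ν → Eq I c sats ν , Ep I c sats ν
    where
    bqp : Boolean (q ∧ p)
    bqp x (∧l f) = bq x f
    bqp x (∧r f) = bp x f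
    cqp : ConstsIn (q ∧ p) D
    cqp c (∧l k) = cq c k
    cqp c (∧r k) = cp c k

-- Models of TGDs are closed under products

triangle : ℕ → ℕ
triangle zero    = zero
triangle (suc n) = triangle n + suc n

pairℕ : ℕ → ℕ → ℕ
pairℕ a b = triangle (a + b) + a

nextPair : ℕ × ℕ → ℕ × ℕ
nextPair (a , zero)  = zero , suc a
nextPair (a , suc b) = suc a , b

-- Enumerates ℕ × ℕ diagonal by diagonal, in the order of pairℕ.
unpairℕ : ℕ → ℕ × ℕ
unpairℕ zero    = zero , zero
unpairℕ (suc k) = nextPair (unpairℕ k)

unpairℕ-diagonal : ∀ n a b → a + b ≡ n → unpairℕ (triangle n + a) ≡ (a , b)
unpairℕ-diagonal n (suc a) b e =
  trans (cong unpairℕ (+-suc (triangle n) a))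
        (cong nextPair (unpairℕ-diagonal n a (suc b) (trans (+-suc a b) e)))
unpairℕ-diagonal zero    zero zero      refl = refl
unpairℕ-diagonal (suc n) zero (suc .n) refl =
  trans (cong unpairℕ (trans (+-identityʳ (triangle n + suc n)) (+-suc (triangle n) n)))
        (cong nextPair (unpairℕ-diagonal n n zero (+-identityʳ n)))

unpairℕ-pairℕ : ∀ a b → unpairℕ (pairℕ a b) ≡ (a , b)
unpairℕ-pairℕ a b = unpairℕ-diagonal (a + b) a b refl

encodeVal : Val → ℕ
encodeVal (cst zero)    = 0
encodeVal (cst (suc c)) = suc (suc (encodeVal (cst c)))
encodeVal (nul zero)    = 1
encodeVal (nul (suc m)) = suc (suc (encodeVal (nul m)))

sucVal : Val → Val
sucVal (cst c) = cst (suc c)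
sucVal (nul m) = nul (suc m)

decodeVal : ℕ → Val
decodeVal zero          = cst 0
decodeVal (suc zero)    = nul 0
decodeVal (suc (suc k)) = sucVal (decodeVal k)

decodeVal-encodeVal : ∀ v → decodeVal (encodeVal v) ≡ v
decodeVal-encodeVal (cst zero)    = refl
decodeVal-encodeVal (cst (suc c)) = cong sucVal (decodeVal-encodeVal (cst c))
decodeVal-encodeVal (nul zero)    = refl
decodeVal-encodeVal (nul (suc m)) = cong sucVal (decodeVal-encodeVal (nul m))

pairVal : Val → Val → Val
pairVal u v = nul (pairℕ (encodeVal u) (encodeVal v))

-- A constant c stands for the pair (c , 1).  TGDs mention no constants, so any
-- choice would do for them; this one puts P(0) into J ⊗ J when P(0), P(1) ∈ J.
fstVal sndVal : Val → Val
fstVal (cst c) = cst c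
fstVal (nul m) = decodeVal (proj₁ (unpairℕ m))
sndVal (cst c) = cst 1
sndVal (nul m) = decodeVal (proj₂ (unpairℕ m))

fstVal-pairVal : ∀ u v → fstVal (pairVal u v) ≡ u
fstVal-pairVal u v =
  trans (cong (decodeVal ∘ proj₁) (unpairℕ-pairℕ (encodeVal u) (encodeVal v))) (decodeVal-encodeVal u)

sndVal-pairVal : ∀ u v → sndVal (pairVal u v) ≡ v
sndVal-pairVal u v =
  trans (cong (decodeVal ∘ proj₂) (unpairℕ-pairℕ (encodeVal u) (encodeVal v))) (decodeVal-encodeVal v)

pair-extension : {Fixed : ℕ → Set} → (∀ v → Dec (Fixed v)) → ∀ (h g₁ g₂ : ℕ → Val) →
                 (∀ v → Fixed v → g₁ v ≡ fstVal (h v)) → (∀ v → Fixed v → g₂ v ≡ sndVal (h v)) →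
                 ∃ λ h′ → (∀ v → Fixed v → h′ v ≡ h v) ×
                          (∀ v → fstVal (h′ v) ≡ g₁ v) × (∀ v → sndVal (h′ v) ≡ g₂ v)
pair-extension fixed? h g₁ g₂ e₁ e₂ = h′ , agree , fst-h′ , snd-h′
  where
  h′ : ℕ → Val
  h′ v with fixed? v
  ... | yes _ = h v
  ... | no _  = pairVal (g₁ v) (g₂ v)
  agree : ∀ v → _ → h′ v ≡ h v
  agree v fixed with fixed? v
  ... | yes _     = refl
  ... | no ¬fixed = ⊥-elim (¬fixed fixed)
  fst-h′ : ∀ v → fstVal (h′ v) ≡ g₁ v
  fst-h′ v with fixed? v
  ... | yes fixed = sym (e₁ v fixed)
  ... | no _      = fstVal-pairVal (g₁ v) (g₂ v)
  snd-h′ : ∀ v → sndVal (h′ v) ≡ g₂ v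
  snd-h′ v with fixed? v
  ... | yes fixed = sym (e₂ v fixed)
  ... | no _      = sndVal-pairVal (g₁ v) (g₂ v)

_⊗_ : Instance → Instance → Instance
(I ⊗ J) a = pullback fstVal I a × pullback sndVal J a

bodyVar? : ∀ σ v → Dec (BodyVar v σ)
bodyVar? σ v = Any.any? (λ a → VecAny.any? (λ t → v ≟ t) (args a)) (toList (body σ))

tgd-product : ∀ (I J : Instance) t → SatDTGD I (toDTGD t) → SatDTGD J (toDTGD t) →
              SatDTGD (I ⊗ J) (toDTGD t)
tgd-product I J t satI satJ h hb
  with satI (fstVal ∘ h) (holds-pullback⁻ I fstVal (tbody t) (proj₁ (All.unzip hb)))
     | satJ (sndVal ∘ h) (holds-pullback⁻ J sndVal (tbody t) (proj₂ (All.unzip hb)))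
... | here (g₁ , g₁≡ , hd₁) | here (g₂ , g₂≡ , hd₂) =
  let h′ , agree , fst-h′ , snd-h′ = pair-extension (bodyVar? (toDTGD t)) h g₁ g₂ g₁≡ g₂≡
  in here (h′ , agree , All.zip
       ( holds-pullback⁺ I fstVal (thead t) (holds-cong-∈ I (thead t) (λ _ _ → sym (fst-h′ _)) hd₁)
       , holds-pullback⁺ J sndVal (thead t) (holds-cong-∈ J (thead t) (λ _ _ → sym (snd-h′ _)) hd₂)))

tgds-product : ∀ (I J : Instance) (T : List TGD) →
               All (SatDTGD I) (map toDTGD T) → All (SatDTGD J) (map toDTGD T) →
               All (SatDTGD (I ⊗ J)) (map toDTGD T)
tgds-product I J []      []           []           = []
tgds-product I J (t ∷ T) (satI ∷ satsI) (satJ ∷ satsJ) = tgd-product I J t satI satJ ∷ tgds-product I J T satsI satsJ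

-- The separating example

P A B : {Term : Set} → Term → Atom Term
P x = mkAtom (0 , 1) (x Vec.∷ Vec.[])
A x = mkAtom (1 , 1) (x Vec.∷ Vec.[])
B x = mkAtom (2 , 1) (x Vec.∷ Vec.[])

𝒟₀ 𝒬₀ : Schema
𝒟₀ = (0 , 1) ∷ []
𝒬₀ = (1 , 1) ∷ (2 , 1) ∷ []

𝒟₀-disjoint-𝒬₀ : Disjoint 𝒟₀ 𝒬₀
𝒟₀-disjoint-𝒬₀ r s (here refl) (here refl)         ()
𝒟₀-disjoint-𝒬₀ r s (here refl) (there (here refl)) ()

P⇒A∨B : DTGD
P⇒A∨B = mkDTGD (P 0 List⁺.∷ []) ((A 0 List⁺.∷ []) List⁺.∷ (B 0 List⁺.∷ []) ∷ [])

P⇒A∨B-full : FullDTGD P⇒A∨B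
P⇒A∨B-full (here refl)         (here refl) (VecAny.here refl) = here (VecAny.here refl)
P⇒A∨B-full (there (here refl)) (here refl) (VecAny.here refl) = here (VecAny.here refl)

D₁ D₂ : Database
D₁ = P 0 ∷ []
D₂ = P 0 ∷ P 1 ∷ []

q₁ q₂ : UCQ
q₁ = atom (A (con 0)) ∨ atom (B (con 0))
q₂ = (atom (A (con 0)) ∧ atom (A (con 1))) ∨ (atom (B (con 0)) ∧ atom (B (con 1)))

unary-ground-atom-boolean : ∀ {x} r c → ¬ FreeIn x (atom (mkAtom (r , 1) (con c Vec.∷ Vec.[])))
unary-ground-atom-boolean r c (atm (VecAny.here ()))
unary-ground-atom-boolean r c (atm (VecAny.there ()))

admissible-D₁-q₁ : Admissible 𝒟₀ 𝒬₀ D₁ q₁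
admissible-D₁-q₁ = (λ ()) , here refl ∷ [] , boolean , (here refl , there (here refl)) , consts
  where
  boolean : Boolean q₁
  boolean x (∨l f) = unary-ground-atom-boolean 1 0 f
  boolean x (∨r f) = unary-ground-atom-boolean 2 0 f
  consts : ConstsIn q₁ D₁
  consts c (∨l (atm (VecAny.here refl))) = here (VecAny.here refl)
  consts c (∨r (atm (VecAny.here refl))) = here (VecAny.here refl)

admissible-D₂-q₂ : Admissible 𝒟₀ 𝒬₀ D₂ q₂
admissible-D₂-q₂ =
  (λ ()) , here refl ∷ here refl ∷ [] , boolean ,
  ((here refl , here refl) , (there (here refl) , there (here refl))) , consts
  where
  boolean : Boolean q₂
  boolean x (∨l (∧l f)) = unary-ground-atom-boolean 1 0 f
  boolean x (∨l (∧r f)) = unary-ground-atom-boolean 1 1 f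
  boolean x (∨r (∧l f)) = unary-ground-atom-boolean 2 0 f
  boolean x (∨r (∧r f)) = unary-ground-atom-boolean 2 1 f
  consts : ConstsIn q₂ D₂
  consts c (∨l (∧l (atm (VecAny.here refl)))) = here (VecAny.here refl)
  consts c (∨l (∧r (atm (VecAny.here refl)))) = there (here (VecAny.here refl))
  consts c (∨r (∧l (atm (VecAny.here refl)))) = here (VecAny.here refl)
  consts c (∨r (∧r (atm (VecAny.here refl)))) = there (here (VecAny.here refl))

D₁-entails-q₁ : Entails D₁ (P⇒A∨B ∷ []) q₁
D₁-entails-q₁ I c (sat ∷ []) ν with sat (λ _ → cst 0) (c _ (here refl) ∷ [])
... | here (h , h≡ , a ∷ [])         = inj₁ (subst (I ∘ A) (h≡ 0 (here (VecAny.here refl))) a)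
... | there (here (h , h≡ , b ∷ [])) = inj₂ (subst (I ∘ B) (h≡ 0 (here (VecAny.here refl))) b)

M : Instance
M (mkAtom (0 , 1) (cst 0 Vec.∷ Vec.[])) = ⊤
M (mkAtom (0 , 1) (cst 1 Vec.∷ Vec.[])) = ⊤
M (mkAtom (1 , 1) (cst 0 Vec.∷ Vec.[])) = ⊤
M (mkAtom (2 , 1) (cst 1 Vec.∷ Vec.[])) = ⊤
M _ = ⊥

M-cover : ∀ v → M (P v) → M (A v) ⊎ M (B v)
M-cover (cst 0) _ = inj₁ tt
M-cover (cst 1) _ = inj₂ tt

M-satisfies-P⇒A∨B : SatDTGD M P⇒A∨B
M-satisfies-P⇒A∨B h (p ∷ []) with M-cover (h 0) p
... | inj₁ a = here (h , (λ _ _ → refl) , a ∷ [])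
... | inj₂ b = there (here (h , (λ _ _ → refl) , b ∷ []))

D₂-not-entails-q₂ : ¬ Entails D₂ (P⇒A∨B ∷ []) q₂
D₂-not-entails-q₂ E with E M contains (M-satisfies-P⇒A∨B ∷ []) (λ _ → cst 0)
  where
  contains : Contains M D₂
  contains a (here refl)         = tt
  contains a (there (here refl)) = tt
... | inj₁ (_ , ())
... | inj₂ (() , _)

tgds-transfer-q₁-to-q₂ : ∀ (T : List TGD) → Entails D₁ (map toDTGD T) q₁ → Entails D₂ (map toDTGD T) q₂
tgds-transfer-q₁-to-q₂ T E J contains sats = E (J ⊗ J) contains-D₁ (tgds-product J J T sats sats)
  where
  contains-D₁ : Contains (J ⊗ J) D₁
  contains-D₁ a (here refl) = contains _ (here refl) , contains _ (there (here refl))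

corollary2 : Σ[ 𝒟 ∈ Schema ] Σ[ 𝒬 ∈ Schema ] (Disjoint 𝒟 𝒬 ×
    Σ[ Σd ∈ List DTGD ] (IsDTGDOntology 𝒟 𝒬 Σd ×
      (∀ (T : List TGD) → ¬ DefinedByTGDs 𝒟 𝒬 (Defined 𝒟 𝒬 Σd) T)))
corollary2 =
  𝒟₀ , 𝒬₀ , 𝒟₀-disjoint-𝒬₀ , P⇒A∨B ∷ [] , full-DTGDs-define-OMQA (P⇒A∨B-full ∷ []) , not-TGD-definable
  where
  not-TGD-definable : ∀ T → ¬ DefinedByTGDs 𝒟₀ 𝒬₀ (Defined 𝒟₀ 𝒬₀ (P⇒A∨B ∷ [])) T
  not-TGD-definable T defines =
    D₂-not-entails-q₂ (proj₂ (proj₂ (defines D₂ q₂) (admissible-D₂-q₂ , T-entails-q₂)))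
    where
    T-entails-q₂ : Entails D₂ (map toDTGD T) q₂
    T-entails-q₂ = tgds-transfer-q₁-to-q₂ T
      (proj₂ (proj₁ (defines D₁ q₁) (admissible-D₁-q₁ , D₁-entails-q₁)))
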